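{- Let $m\geqslant 2$ be an integer, and define $n_2=13$, $n_3=17$, $n_4=23$, and $n_m=4m-1$ for $m\geqslant 5$. Then for all positive integers $w,z\geqslant m$ with $w+z\geqslant n_m$, we have $b_m(w)\,b_m(z)>b_m(w+z)$.
   Context: For an integer $m\geqslant2$, the $m$-ary partition function $b_m(n)$ is the number of partitions of $n$ all of whose parts belong to $\{1,m,m^2,m^3,\ldots\}$. -}

module Defs where

open import Data.Nat using (ℕ; zero; suc; _+_; _*_; _∸_; _^_; _≤ᵇ_)
open import Data.Bool using (if_then_else_)
open import Data.List using (List; []; _∷_; map; upTo)
open import Data.Nat.ListAction using (sum)

-- Number of partitions of n into parts whose sizes are taken from the list
-- ds (ds is assumed to consist of distinct positive sizes).  Each size d may
-- be used any number of times j ≥ 0 (with j * d ≤ n; j ≤ n suffices as d ≥ 1).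
partsCount : List ℕ → ℕ → ℕ
partsCount []       zero    = 1
partsCount []       (suc _) = 0
partsCount (d ∷ ds) n =
  sum (map (λ j → if j * d ≤ᵇ n then partsCount ds (n ∸ j * d) else 0)
           (upTo (suc n)))

powers : ℕ → ℕ → List ℕ
powers m k = map (m ^_) (upTo k)

-- For m ≥ 2, m^k ≥ k+1 > n when k = n, so every power of m
-- that is ≤ n occurs among m^0, ..., m^n, and larger powers cannot occur.
b : ℕ → ℕ → ℕ
b m n = partsCount (powers m (suc n)) n

nThr : ℕ → ℕ
nThr 2 = 13
nThr 3 = 17
nThr 4 = 23
nThr m = 4 * m ∸ 1

-- Splitting off the parts equal to 1 gives b(n+1) = b(n) + [m ∣ n+1] b((n+1)/m).  Hence b is
-- constant on each block [mq, mq+m), with value B q := b(mq), and B(q+1) = b(q+1) + B q.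
-- Together these give b u ≤ B x · b y whenever u ≤ mx + y and B(x + ⌊y/m⌋) ≤ B x · B ⌊y/m⌋;
-- by strong induction on y, B is submultiplicative, and then the strict inequality
-- B(a+c+1) < B a · B c passes from c to c+1 when a ≥ 1.  So it holds for all a, c ≥ 1 with
-- a + c ≥ K as soon as it holds on the line a + c = K: K = 6, 5, 5 for m = 2, 3, 4 (checked by
-- computation) and K = 3 for m ≥ 5, where B q = q + 1 for q < m.  Finally, with a = ⌊w/m⌋ and
-- c = ⌊z/m⌋ we have b w = B a, b z = B c and b(w+z) ≤ B(a+c+1), and the threshold n_m is
-- exactly what forces a + c ≥ K.

module Submission where

open import Defs
open import Data.Bool using (if_then_else_)
open import Data.Bool.Properties using (if-cong-then)
open import Data.List using (List; []; _∷_; _∷ʳ_; map; upTo; applyUpTo)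
open import Data.List.Properties using (map-cong; map-upTo; map-applyUpTo; applyUpTo-∷ʳ)
open import Data.List.Relation.Unary.All using (All; []; _∷_; universal)
open import Data.List.Relation.Unary.All.Properties using (map⁺)
open import Data.Nat
open import Data.Nat.DivMod
open import Data.Nat.Divisibility using (m∣m*n)
open import Data.Nat.Induction using (<-wellFounded)
open import Data.Nat.ListAction using (sum)
open import Data.Nat.Properties
open import Data.Product using (_,_)
open import Data.Sum using (inj₁; inj₂)
open import Function using (_∘_)
open import Induction.WellFounded using (Acc; acc)
open import Relation.Binary.PropositionalEquality
open import Relation.Nullary.Decidable using (True; yes; no; toWitness)
open import Relation.Nullary.Reflects using (ofⁿ; det; fromEquivalence)


≤-transport : ∀ {ℓ} (P : ℕ → Set ℓ) → (∀ {n} → P n → P (suc n)) →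
              ∀ {m n} → m ≤ n → P m → P n
≤-transport P step m≤n = go (≤⇒≤′ m≤n)
  where
  go : ∀ {m n} → m ≤′ n → P m → P n
  go (≤′-reflexive refl) p = p
  go (≤′-step m≤′n)      p = step (go m≤′n p)

≤ᵇ-cancelˡ : ∀ d a b → (d + a ≤ᵇ d + b) ≡ (a ≤ᵇ b)
≤ᵇ-cancelˡ d a b = det (≤ᵇ-reflects-≤ (d + a) (d + b))
  (fromEquivalence (+-monoʳ-≤ d ∘ ≤ᵇ⇒≤ a b) (≤⇒≤ᵇ ∘ +-cancelˡ-≤ d a b))

m*n+o<m*p : ∀ {m n o p} → o < m → n < p → m * n + o < m * p
m*n+o<m*p {m} {n} {o} {p} o<m n<p = begin-strict
  m * n + o  <⟨ +-monoʳ-< (m * n) o<m ⟩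
  m * n + m  ≡⟨ +-comm (m * n) m ⟩
  m + m * n  ≡⟨ *-suc m n ⟨
  m * suc n  ≤⟨ *-monoʳ-≤ m n<p ⟩
  m * p      ∎
  where open ≤-Reasoning

m<[1+m/n]*n : ∀ m n .{{_ : NonZero n}} → m < suc (m / n) * n
m<[1+m/n]*n m n = begin-strict
  m                  ≡⟨ m≡m%n+[m/n]*n m n ⟩
  m % n + m / n * n  <⟨ +-monoˡ-< (m / n * n) (m%n<n m n) ⟩
  suc (m / n) * n    ∎
  where open ≤-Reasoning

[m*n+o]/m≡n+o/m : ∀ m n o .{{_ : NonZero m}} → (m * n + o) / m ≡ n + o / m
[m*n+o]/m≡n+o/m m n o = trans (+-distrib-/-∣ˡ o (m∣m*n n))
  (cong (_+ o / m) (trans (/-congˡ (*-comm m n)) (m*n/n≡m n m)))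

m≡n*[m/n]+m%n : ∀ m n .{{_ : NonZero n}} → m ≡ n * (m / n) + m % n
m≡n*[m/n]+m%n m n = trans (m≡m%n+[m/n]*n m n)
  (trans (+-comm (m % n) _) (cong (_+ m % n) (*-comm (m / n) n)))

n<m^n : ∀ {m} → 1 < m → ∀ n → n < m ^ n
n<m^n _         zero    = z<s
n<m^n {m} 1<m (suc n) = ≤-<-trans (n<m^n 1<m n) (^-monoʳ-< m 1<m (n<1+n n))

powers-suc : ∀ m L → powers m (suc L) ≡ 1 ∷ map (m *_) (powers m L)
powers-suc m L = cong (1 ∷_) (begin
  map (m ^_) (applyUpTo suc L)     ≡⟨ map-applyUpTo suc (m ^_) L ⟩
  applyUpTo ((m ^_) ∘ suc) L       ≡⟨ map-applyUpTo (m ^_) (m *_) L ⟨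
  map (m *_) (applyUpTo (m ^_) L)  ≡⟨ cong (map (m *_)) (map-upTo (m ^_) L) ⟨
  map (m *_) (powers m L)          ∎)
  where open ≡-Reasoning

powers-∷ʳ : ∀ m L → powers m L ∷ʳ m ^ L ≡ powers m (suc L)
powers-∷ʳ m L = begin
  powers m L ∷ʳ m ^ L          ≡⟨ cong (_∷ʳ m ^ L) (map-upTo (m ^_) L) ⟩
  applyUpTo (m ^_) L ∷ʳ m ^ L  ≡⟨ applyUpTo-∷ʳ (m ^_) L ⟩
  applyUpTo (m ^_) (suc L)     ≡⟨ map-upTo (m ^_) (suc L) ⟨
  powers m (suc L)             ∎
  where open ≡-Reasoning

powers-pos : ∀ m .{{_ : NonZero m}} L → All (0 <_) (powers m L)
powers-pos m L = map⁺ (universal (m^n>0 m) (upTo L))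

open ≤-Reasoning

sum-applyUpTo-cong : ∀ {f g : ℕ → ℕ} → (∀ j → f j ≡ g j) → ∀ n →
                     sum (applyUpTo f n) ≡ sum (applyUpTo g n)
sum-applyUpTo-cong f≗g zero    = refl
sum-applyUpTo-cong f≗g (suc n) = cong₂ _+_ (f≗g 0) (sum-applyUpTo-cong (f≗g ∘ suc) n)

sum-applyUpTo-+ : ∀ (f : ℕ → ℕ) n e → (∀ {j} → n ≤ j → f j ≡ 0) →
                  sum (applyUpTo f (n + e)) ≡ sum (applyUpTo f n)
sum-applyUpTo-+ f zero    zero    _   = refl
sum-applyUpTo-+ f zero    (suc e) f≡0 =
  cong₂ _+_ (f≡0 z≤n) (sum-applyUpTo-+ (f ∘ suc) 0 e (λ _ → f≡0 z≤n))
sum-applyUpTo-+ f (suc n) e       f≡0 =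
  cong (f 0 +_) (sum-applyUpTo-+ (f ∘ suc) n e (f≡0 ∘ s≤s))

partsCountWith : ℕ → List ℕ → ℕ → ℕ → ℕ
partsCountWith d ds n j = if j * d ≤ᵇ n then partsCount ds (n ∸ j * d) else 0

partsCount-cons : ∀ d ds n →
  partsCount (d ∷ ds) n ≡ sum (applyUpTo (partsCountWith d ds n) (suc n))
partsCount-cons d ds n = cong sum (map-upTo (partsCountWith d ds n) (suc n))

partsCountWith-> : ∀ d ds {n} j → n < j * d → partsCountWith d ds n j ≡ 0
partsCountWith-> d ds {n} j n<jd = cong (λ c → if c then partsCount ds (n ∸ j * d) else 0)
  (det (≤ᵇ-reflects-≤ (j * d) n) (ofⁿ (<⇒≱ n<jd)))

partsCountWith-suc : ∀ d ds n j →
  partsCountWith d ds (d + n) (suc j) ≡ partsCountWith d ds n j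
partsCountWith-suc d ds n j = cong₂ (if_then_else 0)
  (≤ᵇ-cancelˡ d (j * d) n) (cong (partsCount ds) ([m+n]∸[m+o]≡n∸o d n (j * d)))

partsCount-cong : ∀ d {ds ds′} n → (∀ {i} → i ≤ n → partsCount ds i ≡ partsCount ds′ i) →
                  partsCount (d ∷ ds) n ≡ partsCount (d ∷ ds′) n
partsCount-cong d n eq = cong sum (map-cong
  (λ j → if-cong-then (j * d ≤ᵇ n) (eq (m∸n≤m n (j * d)))) (upTo (suc n)))

partsCount-< : ∀ {d} ds {n} → n < d → partsCount (d ∷ ds) n ≡ partsCount ds n
partsCount-< {d} ds {n} n<d = begin-equality
  partsCount (d ∷ ds) n
    ≡⟨ partsCount-cons d ds n ⟩
  partsCount ds n + sum (applyUpTo (partsCountWith d ds n ∘ suc) n)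
    ≡⟨ cong (partsCount ds n +_) (sum-applyUpTo-+ (partsCountWith d ds n ∘ suc) 0 n λ {j} _ →
         partsCountWith-> d ds (suc j) (<-≤-trans n<d (m≤m+n d (j * d)))) ⟩
  partsCount ds n + 0
    ≡⟨ +-identityʳ _ ⟩
  partsCount ds n ∎

partsCount-+ : ∀ {d} ds n → 0 < d →
  partsCount (d ∷ ds) (d + n) ≡ partsCount ds (d + n) + partsCount (d ∷ ds) n
partsCount-+ {d@(suc d′)} ds n _ = begin-equality
  partsCount (d ∷ ds) (d + n)
    ≡⟨ partsCount-cons d ds (d + n) ⟩
  partsCount ds (d + n) + sum (applyUpTo (partsCountWith d ds (d + n) ∘ suc) (d + n))
    ≡⟨ cong (partsCount ds (d + n) +_) (begin-equality
         sum (applyUpTo (partsCountWith d ds (d + n) ∘ suc) (d + n))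
           ≡⟨ sum-applyUpTo-cong (partsCountWith-suc d ds n) (d + n) ⟩
         sum (applyUpTo (partsCountWith d ds n) (suc (d′ + n)))
           ≡⟨ cong (sum ∘ applyUpTo (partsCountWith d ds n) ∘ suc) (+-comm d′ n) ⟩
         sum (applyUpTo (partsCountWith d ds n) (suc n + d′))
           ≡⟨ sum-applyUpTo-+ (partsCountWith d ds n) (suc n) d′ (λ {j} n<j →
               partsCountWith-> d ds j (≤-trans n<j (m≤m*n j d))) ⟩
         sum (applyUpTo (partsCountWith d ds n) (suc n))
           ≡⟨ partsCount-cons d ds n ⟨
         partsCount (d ∷ ds) n ∎) ⟩
  partsCount ds (d + n) + partsCount (d ∷ ds) n ∎

partsCount-∷ʳ : ∀ ds {d n} → n < d → partsCount (ds ∷ʳ d) n ≡ partsCount ds n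
partsCount-∷ʳ []       n<d = partsCount-< [] n<d
partsCount-∷ʳ (e ∷ ds) {d} n<d =
  partsCount-cong e {ds ∷ʳ d} {ds} _ λ i≤n → partsCount-∷ʳ ds (≤-<-trans i≤n n<d)

partsCount-map-* : ∀ {m} → 0 < m → ∀ {ds} → All (0 <_) ds → ∀ q →
                   partsCount (map (m *_) ds) (m * q) ≡ partsCount ds q
partsCount-map-* {suc m′} _ []       zero    rewrite *-zeroʳ m′ = refl
partsCount-map-* {suc m′} _ []       (suc q) = refl
partsCount-map-* {m@(suc _)} m>0 {d@(suc _) ∷ ds} (d>0 ∷ ds>0) q = go q (<-wellFounded q)
  where
  ms = map (m *_) ds
  go : ∀ q → Acc _<_ q → partsCount (m * d ∷ ms) (m * q) ≡ partsCount (d ∷ ds) q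
  go q (acc rec) with ≤-<-connex d q
  ... | inj₂ q<d = begin-equality
    partsCount (m * d ∷ ms) (m * q)  ≡⟨ partsCount-< ms (*-monoʳ-< m q<d) ⟩
    partsCount ms (m * q)            ≡⟨ partsCount-map-* m>0 ds>0 q ⟩
    partsCount ds q                  ≡⟨ partsCount-< ds q<d ⟨
    partsCount (d ∷ ds) q            ∎
  ... | inj₁ d≤q with m≤n⇒∃[o]m+o≡n d≤q
  ... | k , refl = begin-equality
    partsCount (m * d ∷ ms) (m * (d + k))
      ≡⟨ cong (partsCount (m * d ∷ ms)) (*-distribˡ-+ m d k) ⟩
    partsCount (m * d ∷ ms) (m * d + m * k)
      ≡⟨ partsCount-+ ms (m * k) z<s ⟩
    partsCount ms (m * d + m * k) + partsCount (m * d ∷ ms) (m * k)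
      ≡⟨ cong₂ _+_ (trans (sym (cong (partsCount ms) (*-distribˡ-+ m d k)))
                          (partsCount-map-* m>0 ds>0 (d + k)))
                   (go k (rec (m<n+m k d>0))) ⟩
    partsCount ds (d + k) + partsCount (d ∷ ds) k
      ≡⟨ partsCount-+ ds k d>0 ⟨
    partsCount (d ∷ ds) (d + k) ∎

partsCount-map-*-∤ : ∀ {m ds} → All (0 <_) ds → ∀ q {r} → suc r < m →
                     partsCount (map (m *_) ds) (m * q + suc r) ≡ 0
partsCount-map-*-∤ {m} []   q {r} _ rewrite +-suc (m * q) r = refl
partsCount-map-*-∤ {m@(suc _)} {d@(suc _) ∷ ds} (d>0 ∷ ds>0) q {r} r<m = go q (<-wellFounded q)
  where
  ms = map (m *_) ds
  go : ∀ q → Acc _<_ q → partsCount (m * d ∷ ms) (m * q + suc r) ≡ 0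
  go q (acc rec) with ≤-<-connex d q
  ... | inj₂ q<d = trans (partsCount-< ms (m*n+o<m*p r<m q<d)) (partsCount-map-*-∤ ds>0 q r<m)
  ... | inj₁ d≤q with m≤n⇒∃[o]m+o≡n d≤q
  ... | k , refl = begin-equality
    partsCount (m * d ∷ ms) (m * (d + k) + suc r)
      ≡⟨ cong (partsCount (m * d ∷ ms)) split ⟩
    partsCount (m * d ∷ ms) (m * d + (m * k + suc r))
      ≡⟨ partsCount-+ ms (m * k + suc r) z<s ⟩
    partsCount ms (m * d + (m * k + suc r)) + partsCount (m * d ∷ ms) (m * k + suc r)
      ≡⟨ cong₂ _+_ (trans (sym (cong (partsCount ms) split)) (partsCount-map-*-∤ ds>0 (d + k) r<m))
                   (go k (rec (m<n+m k d>0))) ⟩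
    0 ∎
    where
    split : m * (d + k) + suc r ≡ m * d + (m * k + suc r)
    split = trans (cong (_+ suc r) (*-distribˡ-+ m d k)) (+-assoc (m * d) (m * k) (suc r))

module _ (k : ℕ) where

  private
    m : ℕ
    m = 2 + k

  partsCount-powers : ∀ {n L} → n < L → partsCount (powers m L) n ≡ b m n
  partsCount-powers {n} {L} n<L = begin-equality
    partsCount (powers m L) n                      ≡⟨ cong (λ L → partsCount (powers m L) n) (m∸n+n≡m n<L) ⟨
    partsCount (powers m ((L ∸ suc n) + suc n)) n  ≡⟨ extend (L ∸ suc n) ⟩
    b m n                                          ∎
    where
    extend : ∀ e → partsCount (powers m (e + suc n)) n ≡ b m n
    extend zero    = refl
    extend (suc e) = begin-equality
      partsCount (powers m (suc (e + suc n))) n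
        ≡⟨ cong (λ ds → partsCount ds n) (powers-∷ʳ m (e + suc n)) ⟨
      partsCount (powers m (e + suc n) ∷ʳ m ^ (e + suc n)) n
        ≡⟨ partsCount-∷ʳ (powers m (e + suc n))
             (<-trans (m≤n+m (suc n) e) (n<m^n (s<s z<s) (e + suc n))) ⟩
      partsCount (powers m (e + suc n)) n
        ≡⟨ extend e ⟩
      b m n ∎

  partsCount-powers-map-* : ∀ {q L} → q < L → partsCount (map (m *_) (powers m L)) (m * q) ≡ b m q
  partsCount-powers-map-* {q} {L} q<L =
    trans (partsCount-map-* {m} z<s (powers-pos m L) q) (partsCount-powers q<L)

  b-suc : ∀ n → b m (suc n) ≡ partsCount (map (m *_) (powers m (suc n))) (suc n) + b m n
  b-suc n = begin-equality
    b m (suc n)                  ≡⟨ cong (λ ds → partsCount ds (suc n)) (powers-suc m (suc n)) ⟩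
    partsCount (1 ∷ ms) (1 + n)  ≡⟨ partsCount-+ ms n z<s ⟩
    partsCount ms (suc n) + partsCount (1 ∷ ms) n
      ≡⟨ cong (partsCount ms (suc n) +_) (begin-equality
           partsCount (1 ∷ ms) n            ≡⟨ cong (λ ds → partsCount ds n) (powers-suc m (suc n)) ⟨
           partsCount (powers m (2 + n)) n  ≡⟨ partsCount-powers (m<n+m n {2} z<s) ⟩
           b m n                            ∎) ⟩
    partsCount ms (suc n) + b m n  ∎
    where ms = map (m *_) (powers m (suc n))

  B : ℕ → ℕ
  B q = b m (m * q)

  b-block : ∀ q {r} → r < m → b m (m * q + r) ≡ B q
  b-block q {zero}  _   = cong (b m) (+-identityʳ (m * q))
  b-block q {suc r} r<m = begin-equality
    b m (m * q + suc r)    ≡⟨ cong (b m) (+-suc (m * q) r) ⟩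
    b m (suc (m * q + r))  ≡⟨ b-suc (m * q + r) ⟩
    partsCount ms (suc (m * q + r)) + b m (m * q + r)
      ≡⟨ cong₂ _+_ (trans (sym (cong (partsCount ms) (+-suc (m * q) r)))
                          (partsCount-map-*-∤ (powers-pos m (suc (m * q + r))) q r<m))
                   (b-block q (<-trans (n<1+n r) r<m)) ⟩
    B q                    ∎
    where ms = map (m *_) (powers m (suc (m * q + r)))

  b≡B[/] : ∀ n → b m n ≡ B (n / m)
  b≡B[/] n = trans (cong (b m) (m≡n*[m/n]+m%n n m)) (b-block (n / m) (m%n<n n m))

  B-zero : B 0 ≡ 1
  B-zero = cong (b m) (*-zeroʳ m)

  B-suc : ∀ q → B (suc q) ≡ b m (suc q) + B q
  B-suc q = begin-equality
    B (suc q)                                          ≡⟨ cong (b m) m*[1+q]≡1+n ⟩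
    b m (suc n)                                        ≡⟨ b-suc n ⟩
    partsCount ms (suc n) + b m n
      ≡⟨ cong₂ _+_ (trans (sym (cong (partsCount ms) m*[1+q]≡1+n))
                          (partsCount-powers-map-* (s≤s q<n)))
                   (b-block q ≤-refl) ⟩
    b m (suc q) + B q                                  ∎
    where
    n = m * q + suc k
    ms = map (m *_) (powers m (suc n))
    m*[1+q]≡1+n : m * suc q ≡ suc n
    m*[1+q]≡1+n = trans (*-suc m q) (cong suc (+-comm (suc k) (m * q)))
    q<n : q < n
    q<n = ≤-<-trans (m≤n*m q m) (m<m+n (m * q) z<s)

  b-small : ∀ {n} → n < m → b m n ≡ 1
  b-small {n} n<m = trans (b≡B[/] n) (trans (cong B (m<n⇒m/n≡0 n<m)) B-zero)

  B-small : ∀ q → q < m → B q ≡ suc q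
  B-small zero    _   = B-zero
  B-small (suc q) q<m =
    trans (B-suc q) (cong₂ _+_ (b-small q<m) (B-small q (<-trans (n<1+n q) q<m)))

  b≤b-suc : ∀ n → b m n ≤ b m (suc n)
  b≤b-suc n = subst (b m n ≤_) (sym (b-suc n)) (m≤n+m (b m n) (partsCount ms (suc n)))
    where ms = map (m *_) (powers m (suc n))

  b-mono : ∀ {u v} → u ≤ v → b m u ≤ b m v
  b-mono {u} u≤v =
    ≤-transport (λ v → b m u ≤ b m v) (λ {v} bu≤bv → ≤-trans bu≤bv (b≤b-suc v)) u≤v ≤-refl

  B-mono : ∀ {q q′} → q ≤ q′ → B q ≤ B q′
  B-mono q≤q′ = b-mono (*-monoʳ-≤ m q≤q′)

  b≤B*b : ∀ x y {u} → B (x + y / m) ≤ B x * B (y / m) → u ≤ m * x + y → b m u ≤ B x * b m y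
  b≤B*b x y {u} B-sub u≤ = begin
    b m u                ≤⟨ b-mono u≤ ⟩
    b m (m * x + y)      ≡⟨ b≡B[/] (m * x + y) ⟩
    B ((m * x + y) / m)  ≡⟨ cong B ([m*n+o]/m≡n+o/m m x y) ⟩
    B (x + y / m)        ≤⟨ B-sub ⟩
    B x * B (y / m)      ≡⟨ cong (B x *_) (b≡B[/] y) ⟨
    B x * b m y          ∎

  B-submultiplicative : ∀ x y → B (x + y) ≤ B x * B y
  B-submultiplicative x y = go y (<-wellFounded y)
    where
    go : ∀ y → Acc _<_ y → B (x + y) ≤ B x * B y
    go zero _ = begin
      B (x + 0)  ≡⟨ cong B (+-identityʳ x) ⟩
      B x        ≡⟨ *-identityʳ (B x) ⟨
      B x * 1    ≡⟨ cong (B x *_) B-zero ⟨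
      B x * B 0  ∎
    go (suc y) (acc rec) = begin
      B (x + suc y)                  ≡⟨ cong B (+-suc x y) ⟩
      B (suc (x + y))                ≡⟨ B-suc (x + y) ⟩
      b m (suc (x + y)) + B (x + y)  ≤⟨ +-mono-≤ (b≤B*b x (suc y) (go _ (rec (m/n<m (suc y) m (s<s z<s)))) bound)
                                                (go y (rec (n<1+n y))) ⟩
      B x * b m (suc y) + B x * B y  ≡⟨ *-distribˡ-+ (B x) _ _ ⟨
      B x * (b m (suc y) + B y)      ≡⟨ cong (B x *_) (B-suc y) ⟨
      B x * B (suc y)                ∎
      where
      bound : suc (x + y) ≤ m * x + suc y
      bound = ≤-trans (≤-reflexive (sym (+-suc x y))) (+-monoˡ-≤ (suc y) (m≤n*m x m))

  Strict : ℕ → ℕ → Set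
  Strict a c = B (suc (a + c)) < B a * B c

  Strict-sym : ∀ {a c} → Strict a c → Strict c a
  Strict-sym {a} {c} = subst₂ _<_ (cong (B ∘ suc) (+-comm a c)) (*-comm (B a) (B c))

  Strict-suc : ∀ {a c} → 0 < a → Strict a c → Strict a (suc c)
  Strict-suc {a} {c} a>0 S = begin-strict
    B (suc (a + suc c))                        ≡⟨ cong (B ∘ suc) (+-suc a c) ⟩
    B (suc (suc (a + c)))                      ≡⟨ B-suc (suc (a + c)) ⟩
    b m (suc (suc (a + c))) + B (suc (a + c))
      <⟨ +-mono-≤-< (b≤B*b a (suc c) (B-submultiplicative a _) bound) S ⟩
    B a * b m (suc c) + B a * B c              ≡⟨ *-distribˡ-+ (B a) _ _ ⟨
    B a * (b m (suc c) + B c)                  ≡⟨ cong (B a *_) (B-suc c) ⟨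
    B a * B (suc c)                            ∎
    where
    1+a≤m*a : suc a ≤ m * a
    1+a≤m*a = begin
      suc a            ≡⟨ +-comm 1 a ⟩
      a + 1            ≤⟨ +-monoʳ-≤ a (≤-trans a>0 (m≤m+n a (k * a))) ⟩
      a + (a + k * a)  ∎
    bound : suc (suc (a + c)) ≤ m * a + suc c
    bound = begin
      suc (suc (a + c))  ≡⟨ cong suc (+-suc a c) ⟨
      suc a + suc c      ≤⟨ +-monoˡ-≤ (suc c) 1+a≤m*a ⟩
      m * a + suc c      ∎

  Strict-mono : ∀ {a c c′} → 0 < a → c ≤ c′ → Strict a c → Strict a c′
  Strict-mono {a} a>0 = ≤-transport (Strict a) (Strict-suc a>0)

  StrictLevel : ℕ → Set
  StrictLevel K = ∀ a → 0 < a → a < K → Strict a (K ∸ a)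

  Strict-≥level : ∀ {K} → StrictLevel K → 1 < K →
                  ∀ {a c} → 0 < a → 0 < c → K ≤ a + c → Strict a c
  Strict-≥level {K} level 1<K {a} {c} a>0 c>0 K≤a+c with a <? K
  ... | yes a<K = Strict-mono {a} a>0 K∸a≤c (level a a>0 a<K)
    where
    K∸a≤c : K ∸ a ≤ c
    K∸a≤c = subst (K ∸ a ≤_) (m+n∸m≡n a c) (∸-monoˡ-≤ a K≤a+c)
  ... | no a≮K =
    Strict-mono {a} a>0 c>0 (Strict-sym {1} {a} (Strict-mono {1} z<s K∸1≤a (level 1 z<s 1<K)))
    where
    K∸1≤a : K ∸ 1 ≤ a
    K∸1≤a = ≤-trans (m∸n≤m K 1) (≮⇒≥ a≮K)

  b-strict-submultiplicative : ∀ {K} → StrictLevel K → 1 < K →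
                               ∀ {w z} → m ≤ w → m ≤ z → suc K * m ≤ suc (w + z) →
                               b m (w + z) < b m w * b m z
  b-strict-submultiplicative {K} level 1<K {w} {z} m≤w m≤z bound = begin-strict
    b m (w + z)      ≡⟨ b≡B[/] (w + z) ⟩
    B ((w + z) / m)  ≤⟨ B-mono {_} {suc (a + c)} (≤-pred (m<n*o⇒m/o<n (<⇒≤ 1+w+z<[2+a+c]*m))) ⟩
    B (suc (a + c))  <⟨ Strict-≥level level 1<K (m≥n⇒m/n>0 m≤w) (m≥n⇒m/n>0 m≤z) K≤a+c ⟩
    B a * B c        ≡⟨ cong₂ _*_ (b≡B[/] w) (b≡B[/] z) ⟨
    b m w * b m z    ∎
    where
    a = w / m
    c = z / m
    1+w+z<[2+a+c]*m : suc (w + z) < (2 + (a + c)) * m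
    1+w+z<[2+a+c]*m = begin
      suc (suc (w + z))      ≡⟨ cong suc (+-suc w z) ⟨
      suc w + suc z          ≤⟨ +-mono-≤ (m<[1+m/n]*n w m) (m<[1+m/n]*n z m) ⟩
      suc a * m + suc c * m  ≡⟨ *-distribʳ-+ m (suc a) (suc c) ⟨
      (suc a + suc c) * m    ≡⟨ cong (λ s → suc s * m) (+-suc a c) ⟩
      (2 + (a + c)) * m      ∎
    K≤a+c : K ≤ a + c
    K≤a+c = ≤-pred (≤-pred (*-cancelʳ-< m (suc K) (2 + (a + c)) (≤-<-trans bound 1+w+z<[2+a+c]*m)))

  Strict-1-2 : 4 < m → Strict 1 2
  Strict-1-2 4<m =
    subst₂ _<_ (sym (B≡ 4 ≤-refl)) (sym (cong₂ _*_ (B≡ 1 (s≤s z≤n)) (B≡ 2 (s≤s (s≤s z≤n))))) ≤-refl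
    where
    B≡ : ∀ q → q ≤ 4 → B q ≡ suc q
    B≡ q q≤4 = B-small q (≤-<-trans q≤4 4<m)

  strictLevel-m>4 : 4 < m → StrictLevel 3
  strictLevel-m>4 4<m 1 _ _ = Strict-1-2 4<m
  strictLevel-m>4 4<m 2 _ _ = Strict-sym {1} {2} (Strict-1-2 4<m)
  strictLevel-m>4 _ (suc (suc (suc _))) _ (s≤s (s≤s (s≤s ())))

decide-< : ∀ {x y} → True (x <? y) → x < y
decide-< = toWitness

strictLevel-m≡2 : StrictLevel 0 6
strictLevel-m≡2 1 _ _ = decide-< _
strictLevel-m≡2 2 _ _ = decide-< _
strictLevel-m≡2 3 _ _ = decide-< _
strictLevel-m≡2 4 _ _ = decide-< _
strictLevel-m≡2 5 _ _ = decide-< _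
strictLevel-m≡2 (suc (suc (suc (suc (suc (suc _)))))) _ (s≤s (s≤s (s≤s (s≤s (s≤s (s≤s ()))))))

strictLevel-m≡3 : StrictLevel 1 5
strictLevel-m≡3 1 _ _ = decide-< _
strictLevel-m≡3 2 _ _ = decide-< _
strictLevel-m≡3 3 _ _ = decide-< _
strictLevel-m≡3 4 _ _ = decide-< _
strictLevel-m≡3 (suc (suc (suc (suc (suc _))))) _ (s≤s (s≤s (s≤s (s≤s (s≤s ())))))

strictLevel-m≡4 : StrictLevel 2 5
strictLevel-m≡4 1 _ _ = decide-< _
strictLevel-m≡4 2 _ _ = decide-< _
strictLevel-m≡4 3 _ _ = decide-< _
strictLevel-m≡4 4 _ _ = decide-< _
strictLevel-m≡4 (suc (suc (suc (suc (suc _))))) _ (s≤s (s≤s (s≤s (s≤s (s≤s ())))))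

-- In each case 1 + nThr m is exactly (1 + K) m, so the hypothesis nThr m ≤ w + z is used as is.
theorem4p4 : (m w z : ℕ) → 2 ≤ m → m ≤ w → m ≤ z → nThr m ≤ w + z →
    b m (w + z) < b m w * b m z
theorem4p4 1 _ _ (s≤s ())
theorem4p4 2 _ _ _ m≤w m≤z bound =
  b-strict-submultiplicative 0 strictLevel-m≡2 (s<s z<s) m≤w m≤z (s≤s bound)
theorem4p4 3 _ _ _ m≤w m≤z bound =
  b-strict-submultiplicative 1 strictLevel-m≡3 (s<s z<s) m≤w m≤z (s≤s bound)
theorem4p4 4 _ _ _ m≤w m≤z bound =
  b-strict-submultiplicative 2 strictLevel-m≡4 (s<s z<s) m≤w m≤z (s≤s bound)
theorem4p4 (suc (suc k@(suc (suc (suc _))))) _ _ _ m≤w m≤z bound =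
  b-strict-submultiplicative k (strictLevel-m>4 k (s≤s (s≤s (s≤s (s≤s (s≤s z≤n))))))
    (s<s z<s) m≤w m≤z (s≤s bound)
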